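{- For every integer $d\ge 3$ there exists a simple matroid $M$ of rank $d$ whose independence complex satisfies $h_d(\mathcal{I}(M))=2$.
   Context: A matroid is simple if every subset of size at most $2$ is independent (no loops and no parallel elements). $\mathcal{I}(M)$ is the independence complex of $M$ (faces are the independent sets), of dimension $d-1$ for rank $d$; its $h$-vector is defined by $\sum_{i=0}^d h_i t^i=\sum_{i=0}^d f_{i-1}t^i(1-t)^{d-i}$, where $f_{i}$ is the number of faces of cardinality $i+1$ and $f_{ -1}=1$. -}

module Defs where

open import Data.Nat using (ℕ; zero; suc; _≤_; _<_; _∸_)
open import Data.Nat.Combinatorics using (_C_)
open import Data.Integer as ℤ using (ℤ; +_; -_)
open import Data.Fin using (Fin)
open import Data.Fin.Subset using (Subset; ⊥; _∈_; _∉_; _⊆_; _∪_; ⁅_⁆; ∣_∣)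
open import Data.Vec using (_∷_; [])
open import Data.Bool using (true; false)
open import Data.List using (List; []; _∷_; map; _++_; filter; length; upTo)
open import Data.Product using (∃; _×_; _,_)
open import Relation.Nullary using (Dec; yes; no)
open import Relation.Nullary.Decidable using (_×-dec_)
open import Relation.Unary using (Decidable)
import Data.Nat as ℕ

-- Independence is required to be decidable so that faces can
-- be counted (on a finite ground set this is no restriction classically).
record Matroid (n : ℕ) : Set₁ where
  field
    Indep    : Subset n → Set
    indep?   : Decidable Indep
    indep-∅  : Indep ⊥
    indep-⊆  : ∀ {A B} → A ⊆ B → Indep B → Indep A
    exchange : ∀ {A B} → Indep A → Indep B → ∣ A ∣ < ∣ B ∣ →
               ∃ λ x → x ∈ B × x ∉ A × Indep (A ∪ ⁅ x ⁆)

open Matroid public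

HasRank : ∀ {n} → Matroid n → ℕ → Set
HasRank M d = (∀ A → Indep M A → ∣ A ∣ ≤ d) × ∃ λ A → Indep M A × ∣ A ∣ ≡ d
  where open import Relation.Binary.PropositionalEquality using (_≡_)

Simple : ∀ {n} → Matroid n → Set
Simple {n} M = ∀ (A : Subset n) → ∣ A ∣ ≤ 2 → Indep M A

allSubsets : (n : ℕ) → List (Subset n)
allSubsets zero = [] ∷ []
allSubsets (suc n) = map (true ∷_) (allSubsets n) ++ map (false ∷_) (allSubsets n)

-- f-vector shifted: faceCount M i = f_{i-1} = number of independent sets of cardinality i
faceCount : ∀ {n} → Matroid n → ℕ → ℕ
faceCount {n} M i = length (filter (λ A → indep? M A ×-dec (∣ A ∣ ℕ.≟ i)) (allSubsets n))

sign : ℕ → ℤ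
sign zero = + 1
sign (suc k) = - sign k

sumℤ : List ℤ → ℤ
sumℤ [] = + 0
sumℤ (x ∷ xs) = x ℤ.+ sumℤ xs

-- h-vector of the independence complex of a rank-d matroid:
-- coefficient of t^k in Σ_{i=0}^d f_{i-1} t^i (1-t)^{d-i}, i.e.
-- h_k = Σ_{i=0}^{k} (-1)^{k-i} C(d-i, k-i) f_{i-1}
hVec : ∀ {n} → Matroid n → (d k : ℕ) → ℤ
hVec M d k = sumℤ (map (λ i → sign (k ∸ i) ℤ.* (+ ((d ∸ i) C (k ∸ i))) ℤ.* (+ faceCount M i))
                       (upTo (suc k)))

module Submission where

-- Since the binomial weights in the top entry are all 1, h_d(I(M)) is the
-- alternating face count (-1)^d Σ_{A independent} (-1)^∣A∣ = (-1)^d χ(M)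
-- (hVec-top; here χ is minus the reduced Euler characteristic of I(M)).
-- The independence complex of a direct sum is the join of the complexes, so
-- χ(M ⊕ N) = χ(M) χ(N) (χ-⊕).  The triangle U₂,₃ is simple, of rank 2 and has
-- χ = 1 - 3 + 3 = 1; hence U₂,₃ ⊕ M is simple, of rank d + 2, and has the same
-- top h-number as M (hVec-triangle⊕).  Two explicit simple matroids N₃, N₄ of
-- ranks 3 and 4 with top h-number 2 (checked by exhaustive computation) then
-- give all ranks d ≥ 3 by induction in steps of two.

open import Defs
open import Function using (_∘_)
open import Data.Bool using (Bool; true; false; T; not; _∧_; _∨_; if_then_else_)
open import Data.Bool.Properties using (∨-identityʳ)
open import Data.Nat as ℕ using (ℕ; zero; suc; _≤_; _<_; _≥_; _∸_; z≤n; s≤s)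
import Data.Nat.Properties as ℕₚ
open import Data.Nat.Combinatorics as Comb using (nCn≡1)
open import Data.Integer using (ℤ; +_; -_; _+_; _*_)
import Data.Integer.Properties as ℤₚ
open import Data.Integer.Tactic.RingSolver using (solve-∀)
open import Data.Fin using (zero; suc; _↑ˡ_; _↑ʳ_)
open import Data.Fin.Properties using (any?)
open import Data.Fin.Subset using (Subset; inside; outside; ⊥; _∈_; _∉_; _⊆_; _∪_; ⁅_⁆; ∣_∣)
open import Data.Fin.Subset.Properties
  using (drop-∷-⊆; drop-there; ∪-identityʳ; ∣⊥∣≡0; p⊆q⇒∣p∣≤∣q∣; anySubset?; _⊆?_; _∈?_)
open import Data.Vec using ([]; _∷_; _++_; take; drop; here; there)
open import Data.Vec.Properties using (take++drop≡id)
open import Data.List as List using (List; []; _∷_; map; filter; length; upTo)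
open import Data.List.Properties using (map-∘; map-upTo; map-applyUpTo)
open import Data.List.Membership.Propositional using () renaming (_∈_ to _∈ₗ_)
open import Data.List.Membership.Propositional.Properties using (∈-upTo⁻)
open import Data.List.Relation.Unary.Any using (here; there)
open import Data.Product using (∃; Σ; _×_; _,_; proj₁)
open import Relation.Nullary using (Dec; yes; no; does)
open import Relation.Nullary.Decidable
  using (_×-dec_; _→-dec_; ¬?; T?; True; toWitness; decidable-stable)
open import Relation.Unary using (Pred; Decidable)
open import Relation.Binary.PropositionalEquality
  using (_≡_; refl; sym; trans; cong; cong₂; subst; subst₂; module ≡-Reasoning)

open ≡-Reasoning

∑ : ∀ {X : Set} → List X → (X → ℤ) → ℤ
∑ xs f = sumℤ (map f xs)

private variable
  X Y : Set
  m n : ℕ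

∑-++ : ∀ (xs ys : List X) f → ∑ (xs List.++ ys) f ≡ ∑ xs f + ∑ ys f
∑-++ []       ys f = sym (ℤₚ.+-identityˡ (∑ ys f))
∑-++ (x ∷ xs) ys f = trans (cong (λ s → f x + s) (∑-++ xs ys f)) (sym (ℤₚ.+-assoc (f x) _ _))

∑-map : ∀ (g : X → Y) xs (f : Y → ℤ) → ∑ (map g xs) f ≡ ∑ xs (f ∘ g)
∑-map g xs f = cong sumℤ (sym (map-∘ xs))

∑-cong-∈ : ∀ xs {f g : X → ℤ} → (∀ {x} → x ∈ₗ xs → f x ≡ g x) → ∑ xs f ≡ ∑ xs g
∑-cong-∈ []       e = refl
∑-cong-∈ (x ∷ xs) e = cong₂ _+_ (e (here refl)) (∑-cong-∈ xs (e ∘ there))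

∑-cong : ∀ xs {f g : X → ℤ} → (∀ x → f x ≡ g x) → ∑ xs f ≡ ∑ xs g
∑-cong xs e = ∑-cong-∈ xs (λ {x} _ → e x)

∑-zero : ∀ xs → ∑ xs (λ (_ : X) → + 0) ≡ + 0
∑-zero []       = refl
∑-zero (x ∷ xs) = trans (ℤₚ.+-identityˡ _) (∑-zero xs)

∑-+ : ∀ xs (f g : X → ℤ) → ∑ xs (λ x → f x + g x) ≡ ∑ xs f + ∑ xs g
∑-+ []       f g = refl
∑-+ (x ∷ xs) f g = trans (cong (λ s → f x + g x + s) (∑-+ xs f g)) (interchange (f x) (g x) _ _)
  where interchange : ∀ a b c d → a + b + (c + d) ≡ a + c + (b + d)
        interchange = solve-∀

∑-*ˡ : ∀ xs c (f : X → ℤ) → ∑ xs (λ x → c * f x) ≡ c * ∑ xs f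
∑-*ˡ []       c f = sym (ℤₚ.*-zeroʳ c)
∑-*ˡ (x ∷ xs) c f = trans (cong (λ s → c * f x + s) (∑-*ˡ xs c f)) (sym (ℤₚ.*-distribˡ-+ c (f x) _))

∑-product : ∀ xs (ys : List Y) (f : X → ℤ) (g : Y → ℤ) →
            ∑ xs (λ x → ∑ ys (λ y → f x * g y)) ≡ ∑ xs f * ∑ ys g
∑-product xs ys f g = begin
  ∑ xs (λ x → ∑ ys (λ y → f x * g y))  ≡⟨ ∑-cong xs (λ x → ∑-*ˡ ys (f x) g) ⟩
  ∑ xs (λ x → f x * ∑ ys g)            ≡⟨ ∑-cong xs (λ x → ℤₚ.*-comm (f x) (∑ ys g)) ⟩
  ∑ xs (λ x → ∑ ys g * f x)            ≡⟨ ∑-*ˡ xs (∑ ys g) f ⟩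
  ∑ ys g * ∑ xs f                      ≡⟨ ℤₚ.*-comm (∑ ys g) (∑ xs f) ⟩
  ∑ xs f * ∑ ys g                      ∎

∑-upTo-suc : ∀ k (f : ℕ → ℤ) → ∑ (upTo (suc k)) f ≡ f 0 + ∑ (upTo k) (f ∘ suc)
∑-upTo-suc k f =
  cong (λ s → f 0 + sumℤ s) (trans (map-applyUpTo suc f k) (sym (map-upTo (f ∘ suc) k)))

𝟙 : ∀ {p} {P : Set p} → Dec P → ℕ
𝟙 P? = if does P? then 1 else 0

𝟙-× : ∀ {p q} {P : Set p} {Q : Set q} (P? : Dec P) (Q? : Dec Q) → 𝟙 (P? ×-dec Q?) ≡ 𝟙 P? ℕ.* 𝟙 Q?
𝟙-× (yes _) (yes _) = refl
𝟙-× (yes _) (no  _) = refl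
𝟙-× (no  _) _       = refl

length-filter-∷ : ∀ {p} {P : Pred X p} (P? : Decidable P) x xs →
                  length (filter P? (x ∷ xs)) ≡ 𝟙 (P? x) ℕ.+ length (filter P? xs)
length-filter-∷ P? x xs with does (P? x)
... | true  = refl
... | false = refl

∑-δ : ∀ (g : ℕ → ℤ) c k → c < k → ∑ (upTo k) (λ i → g i * + 𝟙 (c ℕ.≟ i)) ≡ g c
∑-δ g zero (suc k) _ = begin
  ∑ (upTo (suc k)) (λ i → g i * + 𝟙 (0 ℕ.≟ i))      ≡⟨ ∑-upTo-suc k (λ i → g i * + 𝟙 (0 ℕ.≟ i)) ⟩
  g 0 * + 1 + ∑ (upTo k) (λ i → g (suc i) * + 0)  ≡⟨ cong₂ _+_ (ℤₚ.*-identityʳ (g 0))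
                                                       (∑-cong (upTo k) (λ i → ℤₚ.*-zeroʳ (g (suc i)))) ⟩
  g 0 + ∑ (upTo k) (λ _ → + 0)                     ≡⟨ cong (λ s → g 0 + s) (∑-zero (upTo k)) ⟩
  g 0 + + 0                                        ≡⟨ ℤₚ.+-identityʳ (g 0) ⟩
  g 0                                              ∎
∑-δ g (suc c) (suc k) (s≤s c<k) = begin
  ∑ (upTo (suc k)) (λ i → g i * + 𝟙 (suc c ℕ.≟ i))  ≡⟨ ∑-upTo-suc k (λ i → g i * + 𝟙 (suc c ℕ.≟ i)) ⟩
  g 0 * + 0 + ∑ (upTo k) (λ i → g (suc i) * + 𝟙 (c ℕ.≟ i))
                                                    ≡⟨ cong₂ _+_ (ℤₚ.*-zeroʳ (g 0)) (∑-δ (g ∘ suc) c k c<k) ⟩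
  + 0 + g (suc c)                                   ≡⟨ ℤₚ.+-identityˡ (g (suc c)) ⟩
  g (suc c)                                         ∎

∑-by-value : ∀ {p} {P : Pred X p} (P? : Decidable P) (c : X → ℕ) (g : ℕ → ℤ) k →
             (∀ x → P x → c x < k) → ∀ xs →
             ∑ xs (λ x → + 𝟙 (P? x) * g (c x)) ≡
             ∑ (upTo k) (λ i → g i * + length (filter (λ x → P? x ×-dec (c x ℕ.≟ i)) xs))
∑-by-value P? c g k bound [] =
  sym (trans (∑-cong (upTo k) (λ i → ℤₚ.*-zeroʳ (g i))) (∑-zero (upTo k)))
∑-by-value {X = X} P? c g k bound (x ∷ xs) = begin
  + 𝟙 (P? x) * g (c x) + ∑ xs (λ y → + 𝟙 (P? y) * g (c y))
    ≡⟨ cong₂ _+_ (sym (point-mass x)) (∑-by-value P? c g k bound xs) ⟩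
  ∑ (upTo k) (λ i → g i * + 𝟙 (Q i x)) + ∑ (upTo k) (λ i → g i * + count i xs)
    ≡⟨ sym (∑-+ (upTo k) _ _) ⟩
  ∑ (upTo k) (λ i → g i * + 𝟙 (Q i x) + g i * + count i xs)
    ≡⟨ ∑-cong (upTo k) count-∷ ⟩
  ∑ (upTo k) (λ i → g i * + count i (x ∷ xs))
    ∎
  where
    Q : ∀ i y → Dec _
    Q i y = P? y ×-dec (c y ℕ.≟ i)
    count : ℕ → List X → ℕ
    count i ys = length (filter (Q i) ys)

    point-mass : ∀ y → ∑ (upTo k) (λ i → g i * + 𝟙 (P? y ×-dec (c y ℕ.≟ i))) ≡ + 𝟙 (P? y) * g (c y)
    point-mass y with P? y
    ... | yes py = trans (∑-δ g (c y) k (bound y py)) (sym (ℤₚ.*-identityˡ (g (c y))))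
    ... | no  _  = trans (∑-cong (upTo k) (λ i → ℤₚ.*-zeroʳ (g i))) (∑-zero (upTo k))

    count-∷ : ∀ i → g i * + 𝟙 (Q i x) + g i * + count i xs ≡ g i * + count i (x ∷ xs)
    count-∷ i = begin
      g i * + 𝟙 (Q i x) + g i * + count i xs  ≡⟨ ℤₚ.*-distribˡ-+ (g i) _ _ ⟨
      g i * (+ 𝟙 (Q i x) + + count i xs)      ≡⟨ cong (g i *_) (ℤₚ.pos-+ (𝟙 (Q i x)) (count i xs)) ⟨
      g i * + (𝟙 (Q i x) ℕ.+ count i xs)      ≡⟨ cong (λ n → g i * + n) (length-filter-∷ (Q i) x xs) ⟨
      g i * + count i (x ∷ xs)                ∎

sign-+ : ∀ a b → sign (a ℕ.+ b) ≡ sign a * sign b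
sign-+ zero    b = sym (ℤₚ.*-identityˡ (sign b))
sign-+ (suc a) b = trans (cong -_ (sign-+ a b)) (ℤₚ.neg-distribˡ-* (sign a) (sign b))

sign-∸ : ∀ {i d} → i ≤ d → sign (d ∸ i) ≡ sign d * sign i
sign-∸ {d = d} z≤n = sym (ℤₚ.*-identityʳ (sign d))
sign-∸ (s≤s {i} {d} i≤d) = trans (sign-∸ i≤d) (neg*neg (sign d) (sign i))
  where neg*neg : ∀ a b → a * b ≡ (- a) * (- b)
        neg*neg = solve-∀

-- Subsets of a disjoint union Fin (m + n): every such subset is A ++ B with
-- A ⊆ Fin m and B ⊆ Fin n (take++drop≡id), and the usual operations act
-- componentwise.

take-++ : ∀ (A : Subset m) (B : Subset n) → take m (A ++ B) ≡ A
take-++ []      B = refl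
take-++ (a ∷ A) B = cong (a ∷_) (take-++ A B)

drop-++ : ∀ (A : Subset m) (B : Subset n) → drop m (A ++ B) ≡ B
drop-++ []      B = refl
drop-++ (a ∷ A) B = drop-++ A B

∣++∣ : ∀ (A : Subset m) (B : Subset n) → ∣ A ++ B ∣ ≡ ∣ A ∣ ℕ.+ ∣ B ∣
∣++∣ []            B = refl
∣++∣ (inside  ∷ A) B = cong suc (∣++∣ A B)
∣++∣ (outside ∷ A) B = ∣++∣ A B

⊥-++ : ∀ m → ⊥ {m ℕ.+ n} ≡ ⊥ {m} ++ ⊥ {n}
⊥-++ zero    = refl
⊥-++ (suc m) = cong (outside ∷_) (⊥-++ m)

⊆-++ˡ : ∀ {A C : Subset m} {B D : Subset n} → A ++ B ⊆ C ++ D → A ⊆ C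
⊆-++ˡ {A = _ ∷ _} {_ ∷ _} AB⊆CD here with AB⊆CD here
... | here = here
⊆-++ˡ {A = _ ∷ _} {_ ∷ _} AB⊆CD (there x∈A) = there (⊆-++ˡ (drop-∷-⊆ AB⊆CD) x∈A)

⊆-++ʳ : ∀ {A C : Subset m} {B D : Subset n} → A ++ B ⊆ C ++ D → B ⊆ D
⊆-++ʳ {A = []}    {[]}    AB⊆CD = AB⊆CD
⊆-++ʳ {A = _ ∷ _} {_ ∷ _} AB⊆CD = ⊆-++ʳ (drop-∷-⊆ AB⊆CD)

∈-↑ˡ : ∀ {A : Subset m} {x} (B : Subset n) → x ∈ A → x ↑ˡ n ∈ A ++ B
∈-↑ˡ B here        = here
∈-↑ˡ B (there x∈A) = there (∈-↑ˡ B x∈A)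

∈-↑ˡ⁻ : ∀ (A : Subset m) {B : Subset n} x → x ↑ˡ n ∈ A ++ B → x ∈ A
∈-↑ˡ⁻ (_ ∷ A) zero    here    = here
∈-↑ˡ⁻ (_ ∷ A) (suc x) (there x∈AB) = there (∈-↑ˡ⁻ A x x∈AB)

∈-↑ʳ : ∀ (A : Subset m) {B : Subset n} {y} → y ∈ B → m ↑ʳ y ∈ A ++ B
∈-↑ʳ []      y∈B = y∈B
∈-↑ʳ (_ ∷ A) y∈B = there (∈-↑ʳ A y∈B)

∈-↑ʳ⁻ : ∀ (A : Subset m) {B : Subset n} {y} → m ↑ʳ y ∈ A ++ B → y ∈ B
∈-↑ʳ⁻ []      y∈AB         = y∈AB
∈-↑ʳ⁻ (_ ∷ A) (there y∈AB) = ∈-↑ʳ⁻ A y∈AB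

∪-⁅↑ˡ⁆ : ∀ (A : Subset m) (B : Subset n) x → (A ++ B) ∪ ⁅ x ↑ˡ n ⁆ ≡ (A ∪ ⁅ x ⁆) ++ B
∪-⁅↑ˡ⁆ (a ∷ A) B zero    =
  cong ((a ∨ true) ∷_) (trans (∪-identityʳ (A ++ B)) (cong (_++ B) (sym (∪-identityʳ A))))
∪-⁅↑ˡ⁆ (a ∷ A) B (suc x) = cong ((a ∨ false) ∷_) (∪-⁅↑ˡ⁆ A B x)

∪-⁅↑ʳ⁆ : ∀ (A : Subset m) (B : Subset n) y → (A ++ B) ∪ ⁅ m ↑ʳ y ⁆ ≡ A ++ (B ∪ ⁅ y ⁆)
∪-⁅↑ʳ⁆ []      B y = refl
∪-⁅↑ʳ⁆ (a ∷ A) B y = cong₂ _∷_ (∨-identityʳ a) (∪-⁅↑ʳ⁆ A B y)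

+-<-cancel : ∀ {a b c d} → a ℕ.+ b < c ℕ.+ d → c ≤ a → b < d
+-<-cancel ab<cd c≤a = ℕₚ.≰⇒> (λ d≤b → ℕₚ.<⇒≱ ab<cd (ℕₚ.+-mono-≤ c≤a d≤b))

module DirectSum (M : Matroid m) (N : Matroid n) where

  Indep⊕ : Subset (m ℕ.+ n) → Set
  Indep⊕ X = Indep M (take m X) × Indep N (drop m X)

  intro : ∀ A B → Indep M A → Indep N B → Indep⊕ (A ++ B)
  intro A B iA iB = subst (Indep M) (sym (take-++ A B)) iA , subst (Indep N) (sym (drop-++ A B)) iB

  hereditary : ∀ {X Y} → X ⊆ Y → Indep⊕ Y → Indep⊕ X
  hereditary {X} {Y} X⊆Y (iC , iD) = indep-⊆ M (⊆-++ˡ AB⊆CD) iC , indep-⊆ N (⊆-++ʳ AB⊆CD) iD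
    where AB⊆CD : take m X ++ drop m X ⊆ take m Y ++ drop m Y
          AB⊆CD = subst₂ _⊆_ (sym (take++drop≡id m X)) (sym (take++drop≡id m Y)) X⊆Y

  -- augment in a component in which the larger set is larger
  augmentation-++ : ∀ {A C B D} → Indep M A → Indep N B → Indep M C → Indep N D →
                    ∣ A ++ B ∣ < ∣ C ++ D ∣ →
                    ∃ λ z → z ∈ C ++ D × z ∉ A ++ B × Indep⊕ ((A ++ B) ∪ ⁅ z ⁆)
  augmentation-++ {A} {C} {B} {D} iA iB iC iD AB<CD with ∣ A ∣ ℕ.<? ∣ C ∣
  ... | yes A<C =
    let x , x∈C , x∉A , iAx = exchange M iA iC A<C
    in  x ↑ˡ n , ∈-↑ˡ D x∈C , x∉A ∘ ∈-↑ˡ⁻ A x ,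
        subst Indep⊕ (sym (∪-⁅↑ˡ⁆ A B x)) (intro (A ∪ ⁅ x ⁆) B iAx iB)
  ... | no  A≮C =
    let B<D = +-<-cancel (subst₂ _<_ (∣++∣ A B) (∣++∣ C D) AB<CD) (ℕₚ.≮⇒≥ A≮C)
        y , y∈D , y∉B , iBy = exchange N iB iD B<D
    in  m ↑ʳ y , ∈-↑ʳ C y∈D , y∉B ∘ ∈-↑ʳ⁻ A ,
        subst Indep⊕ (sym (∪-⁅↑ʳ⁆ A B y)) (intro A (B ∪ ⁅ y ⁆) iA iBy)

  augmentation : ∀ {X Y} → Indep⊕ X → Indep⊕ Y → ∣ X ∣ < ∣ Y ∣ →
                 ∃ λ z → z ∈ Y × z ∉ X × Indep⊕ (X ∪ ⁅ z ⁆)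
  augmentation {X} {Y} (iA , iB) (iC , iD) =
    subst₂ (λ (X Y : Subset (m ℕ.+ n)) → ∣ X ∣ < ∣ Y ∣ → ∃ λ z → z ∈ Y × z ∉ X × Indep⊕ (X ∪ ⁅ z ⁆))
           (take++drop≡id m X) (take++drop≡id m Y) (augmentation-++ {take m X} {take m Y} iA iB iC iD)

_⊕_ : Matroid m → Matroid n → Matroid (m ℕ.+ n)
_⊕_ {m} M N = record
  { Indep    = Indep⊕
  ; indep?   = λ X → indep? M (take m X) ×-dec indep? N (drop m X)
  ; indep-∅  = subst Indep⊕ (sym (⊥-++ m)) (intro ⊥ ⊥ (indep-∅ M) (indep-∅ N))
  ; indep-⊆  = hereditary
  ; exchange = augmentation
  }
  where open DirectSum M N

RankAtMost : Matroid n → ℕ → Set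
RankAtMost M d = ∀ A → Indep M A → ∣ A ∣ ≤ d

∣parts∣ : ∀ m {n} (X : Subset (m ℕ.+ n)) → ∣ X ∣ ≡ ∣ take m X ∣ ℕ.+ ∣ drop m X ∣
∣parts∣ m X = trans (cong ∣_∣ (sym (take++drop≡id m X))) (∣++∣ (take m X) _)

⊕-rankAtMost : ∀ {M : Matroid m} {N : Matroid n} {r s} →
               RankAtMost M r → RankAtMost N s → RankAtMost (M ⊕ N) (r ℕ.+ s)
⊕-rankAtMost {m} {n} {r = r} {s} bM bN X (iA , iB) =
  subst (_≤ r ℕ.+ s) (sym (∣parts∣ m {n} X)) (ℕₚ.+-mono-≤ (bM (take m X) iA) (bN (drop m X) iB))

⊕-rank : ∀ {M : Matroid m} {N : Matroid n} {r s} →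
         HasRank M r → HasRank N s → HasRank (M ⊕ N) (r ℕ.+ s)
⊕-rank {M = M} {N} (bM , A , iA , ∣A∣≡r) (bN , B , iB , ∣B∣≡s) =
  ⊕-rankAtMost {M = M} {N} bM bN ,
  A ++ B , DirectSum.intro M N A B iA iB , trans (∣++∣ A B) (cong₂ ℕ._+_ ∣A∣≡r ∣B∣≡s)

⊕-simple : ∀ {M : Matroid m} {N : Matroid n} → Simple M → Simple N → Simple (M ⊕ N)
⊕-simple {m} {n} sM sN X ∣X∣≤2 =
  sM (take m X) (ℕₚ.≤-trans (ℕₚ.m≤m+n _ ∣ drop m X ∣) ∣parts∣≤2) ,
  sN (drop m X) (ℕₚ.≤-trans (ℕₚ.m≤n+m _ ∣ take m X ∣) ∣parts∣≤2)
  where ∣parts∣≤2 : ∣ take m X ∣ ℕ.+ ∣ drop m X ∣ ≤ 2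
        ∣parts∣≤2 = subst (_≤ 2) (∣parts∣ m {n} X) ∣X∣≤2

Augments : Subset n → Subset n → Set
Augments A B = ∃ λ x → x ∈ B × x ∉ A × ∣ A ∪ ⁅ x ⁆ ∣ ≡ suc ∣ A ∣

augments-∷ : ∀ {A B : Subset n} a b → Augments A B → Augments (a ∷ A) (b ∷ B)
augments-∷ inside  _ (y , y∈B , y∉A , e) = suc y , there y∈B , y∉A ∘ drop-there , cong suc e
augments-∷ outside _ (y , y∈B , y∉A , e) = suc y , there y∈B , y∉A ∘ drop-there , e

augment : ∀ (A B : Subset n) → ∣ A ∣ < ∣ B ∣ → Augments A B
augment []            []            ()
augment (outside ∷ A) (inside  ∷ B) _         = zero , here , (λ ()) , cong (suc ∘ ∣_∣) (∪-identityʳ A)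
augment (inside  ∷ A) (inside  ∷ B) (s≤s A<B) = augments-∷ inside inside (augment A B A<B)
augment (outside ∷ A) (outside ∷ B) A<B       = augments-∷ outside outside (augment A B A<B)
augment (inside  ∷ A) (outside ∷ B) 1+A<B     = augments-∷ inside outside (augment A B (ℕₚ.<⇒≤ 1+A<B))

uniform : (r n : ℕ) → Matroid n
uniform r n = record
  { Indep    = λ A → ∣ A ∣ ≤ r
  ; indep?   = λ A → ∣ A ∣ ℕ.≤? r
  ; indep-∅  = subst (_≤ r) (sym (∣⊥∣≡0 n)) z≤n
  ; indep-⊆  = λ A⊆B ∣B∣≤r → ℕₚ.≤-trans (p⊆q⇒∣p∣≤∣q∣ A⊆B) ∣B∣≤r
  ; exchange = λ {A} {B} _ ∣B∣≤r A<B →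
      let x , x∈B , x∉A , ∣A+x∣≡1+∣A∣ = augment A B A<B
      in  x , x∈B , x∉A , subst (_≤ r) (sym ∣A+x∣≡1+∣A∣) (ℕₚ.≤-trans A<B ∣B∣≤r)
  }

uniform-simple : ∀ {r} → 2 ≤ r → Simple (uniform r n)
uniform-simple 2≤r A ∣A∣≤2 = ℕₚ.≤-trans ∣A∣≤2 2≤r

U₂,₃ : Matroid 3
U₂,₃ = uniform 2 3

U₂,₃-rank : HasRank U₂,₃ 2
U₂,₃-rank = (λ _ ∣A∣≤2 → ∣A∣≤2) , (inside ∷ inside ∷ outside ∷ []) , ℕₚ.≤-refl , refl

-- The signed face count χ(M) = Σ_{A independent} (-1)^∣A∣, i.e. minus the
-- reduced Euler characteristic of I(M).

weight : Matroid n → Subset n → ℤ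
weight M A = + 𝟙 (indep? M A) * sign ∣ A ∣

χ : Matroid n → ℤ
χ {n} M = ∑ (allSubsets n) (weight M)

χ-by-size : ∀ (M : Matroid n) d → RankAtMost M d →
            χ M ≡ ∑ (upTo (suc d)) (λ i → sign i * + faceCount M i)
χ-by-size {n} M d bound =
  ∑-by-value (indep? M) ∣_∣ sign (suc d) (λ A iA → s≤s (bound A iA)) (allSubsets n)

hVec-top : ∀ (M : Matroid n) d → RankAtMost M d → hVec M d d ≡ sign d * χ M
hVec-top M d bound = begin
  hVec M d d                                               ≡⟨ ∑-cong-∈ (upTo (suc d)) (λ i∈ →
                                                                term (ℕₚ.≤-pred (∈-upTo⁻ i∈))) ⟩
  ∑ (upTo (suc d)) (λ i → sign d * (sign i * + f i))       ≡⟨ ∑-*ˡ (upTo (suc d)) (sign d) _ ⟩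
  sign d * ∑ (upTo (suc d)) (λ i → sign i * + f i)         ≡⟨ cong (sign d *_) (χ-by-size M d bound) ⟨
  sign d * χ M                                             ∎
  where
    f : ℕ → ℕ
    f = faceCount M

    term : ∀ {i} → i ≤ d → sign (d ∸ i) * + ((d ∸ i) Comb.C (d ∸ i)) * + f i ≡ sign d * (sign i * + f i)
    term {i} i≤d = begin
      sign (d ∸ i) * + ((d ∸ i) Comb.C (d ∸ i)) * + f i
        ≡⟨ cong (λ c → sign (d ∸ i) * + c * + f i) (nCn≡1 (d ∸ i)) ⟩
      sign (d ∸ i) * + 1 * + f i
        ≡⟨ cong (_* + f i) (ℤₚ.*-identityʳ (sign (d ∸ i))) ⟩
      sign (d ∸ i) * + f i
        ≡⟨ cong (_* + f i) (sign-∸ i≤d) ⟩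
      sign d * sign i * + f i
        ≡⟨ ℤₚ.*-assoc (sign d) (sign i) (+ f i) ⟩
      sign d * (sign i * + f i)
        ∎

∑-allSubsets-++ : ∀ m {n} (f : Subset (m ℕ.+ n) → ℤ) →
                  ∑ (allSubsets (m ℕ.+ n)) f ≡
                  ∑ (allSubsets m) (λ A → ∑ (allSubsets n) (λ B → f (A ++ B)))
∑-allSubsets-++ zero    f = sym (ℤₚ.+-identityʳ _)
∑-allSubsets-++ (suc m) {n} f = begin
  ∑ (map (true ∷_) L List.++ map (false ∷_) L) f
    ≡⟨ ∑-++ (map (true ∷_) L) _ f ⟩
  ∑ (map (true ∷_) L) f + ∑ (map (false ∷_) L) f
    ≡⟨ cong₂ _+_ (∑-map _ L f) (∑-map _ L f) ⟩
  ∑ L (f ∘ (true ∷_)) + ∑ L (f ∘ (false ∷_))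
    ≡⟨ cong₂ _+_ (∑-allSubsets-++ m _) (∑-allSubsets-++ m _) ⟩
  ∑ Lm (F ∘ (true ∷_)) + ∑ Lm (F ∘ (false ∷_))
    ≡⟨ cong₂ _+_ (∑-map _ Lm F) (∑-map _ Lm F) ⟨
  ∑ (map (true ∷_) Lm) F + ∑ (map (false ∷_) Lm) F
    ≡⟨ ∑-++ (map (true ∷_) Lm) _ F ⟨
  ∑ (allSubsets (suc m)) F
    ∎
  where
    L : List (Subset (m ℕ.+ n))
    L = allSubsets (m ℕ.+ n)
    Lm : List (Subset m)
    Lm = allSubsets m
    F : Subset (suc m) → ℤ
    F A = ∑ (allSubsets n) (λ B → f (A ++ B))

weight-++ : ∀ (M : Matroid m) (N : Matroid n) A B → weight (M ⊕ N) (A ++ B) ≡ weight M A * weight N B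
weight-++ {m} M N A B = begin
  + 𝟙 (indep? M (take m (A ++ B)) ×-dec indep? N (drop m (A ++ B))) * sign ∣ A ++ B ∣
    ≡⟨ cong₂ (λ P Q → + 𝟙 (indep? M P ×-dec indep? N Q) * sign ∣ A ++ B ∣) (take-++ A B) (drop-++ A B) ⟩
  + 𝟙 (indep? M A ×-dec indep? N B) * sign ∣ A ++ B ∣
    ≡⟨ cong₂ (λ c s → + c * s) (𝟙-× (indep? M A) (indep? N B))
             (trans (cong sign (∣++∣ A B)) (sign-+ ∣ A ∣ ∣ B ∣)) ⟩
  + (𝟙 (indep? M A) ℕ.* 𝟙 (indep? N B)) * (sign ∣ A ∣ * sign ∣ B ∣)
    ≡⟨ cong (_* (sign ∣ A ∣ * sign ∣ B ∣)) (ℤₚ.pos-* (𝟙 (indep? M A)) (𝟙 (indep? N B))) ⟩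
  + 𝟙 (indep? M A) * + 𝟙 (indep? N B) * (sign ∣ A ∣ * sign ∣ B ∣)
    ≡⟨ interchange (+ 𝟙 (indep? M A)) (+ 𝟙 (indep? N B)) (sign ∣ A ∣) (sign ∣ B ∣) ⟩
  weight M A * weight N B
    ∎
  where interchange : ∀ a b c d → a * b * (c * d) ≡ a * c * (b * d)
        interchange = solve-∀

-- χ is multiplicative: χ(M ⊕ N) = χ(M) χ(N)   (the independence complex of a
-- direct sum is the join of the independence complexes)
χ-⊕ : ∀ (M : Matroid m) (N : Matroid n) → χ (M ⊕ N) ≡ χ M * χ N
χ-⊕ {m} {n} M N = begin
  χ (M ⊕ N)
    ≡⟨ ∑-allSubsets-++ m (weight (M ⊕ N)) ⟩
  ∑ (allSubsets m) (λ A → ∑ (allSubsets n) (λ B → weight (M ⊕ N) (A ++ B)))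
    ≡⟨ ∑-cong (allSubsets m) (λ A → ∑-cong (allSubsets n) (weight-++ M N A)) ⟩
  ∑ (allSubsets m) (λ A → ∑ (allSubsets n) (λ B → weight M A * weight N B))
    ≡⟨ ∑-product (allSubsets m) (allSubsets n) (weight M) (weight N) ⟩
  χ M * χ N
    ∎

-- χ(U₂,₃) = 1 - 3 + 3
χ-U₂,₃ : χ U₂,₃ ≡ + 1
χ-U₂,₃ = refl

hVec-triangle⊕ : ∀ (M : Matroid n) d → RankAtMost M d →
                 hVec (U₂,₃ ⊕ M) (suc (suc d)) (suc (suc d)) ≡ hVec M d d
hVec-triangle⊕ M d bound = begin
  hVec (U₂,₃ ⊕ M) (suc (suc d)) (suc (suc d))
    ≡⟨ hVec-top (U₂,₃ ⊕ M) (suc (suc d)) (⊕-rankAtMost {M = U₂,₃} {M} (proj₁ U₂,₃-rank) bound) ⟩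
  - - sign d * χ (U₂,₃ ⊕ M)    ≡⟨ cong₂ _*_ (ℤₚ.neg-involutive (sign d)) (χ-⊕ U₂,₃ M) ⟩
  sign d * (χ U₂,₃ * χ M)      ≡⟨ cong (λ c → sign d * (c * χ M)) χ-U₂,₃ ⟩
  sign d * (+ 1 * χ M)         ≡⟨ cong (sign d *_) (ℤₚ.*-identityˡ (χ M)) ⟩
  sign d * χ M                 ≡⟨ hVec-top M d bound ⟨
  hVec M d d                   ∎

-- Small matroids given by a Boolean independence predicate; their axioms (and
-- rank and simplicity) are confirmed by exhaustive search over all subsets.

all-subsets? : ∀ {p} {P : Subset n → Set p} → Decidable P → Dec (∀ A → P A)
all-subsets? P? with anySubset? (λ A → ¬? (P? A))
... | yes (A , ¬PA) = no (λ ∀P → ¬PA (∀P A))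
... | no  ∄¬P       = yes (λ A → decidable-stable (P? A) (λ ¬PA → ∄¬P (A , ¬PA)))

module Exhaustive (indep : Subset n → Bool) where

  Independent : Subset n → Set
  Independent A = T (indep A)

  hereditary? : Dec (∀ A B → A ⊆ B → Independent B → Independent A)
  hereditary? = all-subsets? λ A → all-subsets? λ B → (A ⊆? B) →-dec T? (indep B) →-dec T? (indep A)

  augmentation? : Dec (∀ A B → Independent A → Independent B → ∣ A ∣ < ∣ B ∣ →
                       ∃ λ x → x ∈ B × x ∉ A × Independent (A ∪ ⁅ x ⁆))
  augmentation? = all-subsets? λ A → all-subsets? λ B →
    T? (indep A) →-dec T? (indep B) →-dec ∣ A ∣ ℕ.<? ∣ B ∣ →-dec
    any? (λ x → (x ∈? B) ×-dec ¬? (x ∈? A) ×-dec T? (indep (A ∪ ⁅ x ⁆)))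

  matroid : T (indep ⊥) → True hereditary? → True augmentation? → Matroid n
  matroid indep-∅ hereditary augmentation = record
    { Indep    = Independent
    ; indep?   = λ A → T? (indep A)
    ; indep-∅  = indep-∅
    ; indep-⊆  = λ {A} {B} → toWitness hereditary A B
    ; exchange = λ {A} {B} → toWitness augmentation A B
    }

  rankAtMost? : ∀ d → Dec (∀ A → Independent A → ∣ A ∣ ≤ d)
  rankAtMost? d = all-subsets? λ A → T? (indep A) →-dec ∣ A ∣ ℕ.≤? d

  simple? : Dec (∀ A → ∣ A ∣ ≤ 2 → Independent A)
  simple? = all-subsets? λ A → ∣ A ∣ ℕ.≤? 2 →-dec T? (indep A)

-- N₃: rank 3 on {p, q₁, q₂, r₁, r₂}, with two three-point lines {p,q₁,q₂} and
-- {p,r₁,r₂} through p.  f = (1, 5, 10, 8), so h₃ = 8 - 10 + 5 - 1 = 2.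
indep₃ : Subset 5 → Bool
indep₃ A@(p ∷ q₁ ∷ q₂ ∷ r₁ ∷ r₂ ∷ []) = (∣ A ∣ ℕ.≤ᵇ 3) ∧ not (p ∧ q₁ ∧ q₂) ∧ not (p ∧ r₁ ∧ r₂)

N₃ : Matroid 5
N₃ = Exhaustive.matroid indep₃ _ _ _

-- N₄: rank 4 on {p, q₁, q₂, r₁, r₂, r₃}, with the circuits {p,q₁,q₂} and
-- {p,r₁,r₂,r₃}.  f = (1, 6, 15, 19, 11), so h₄ = 11 - 19 + 15 - 6 + 1 = 2.
indep₄ : Subset 6 → Bool
indep₄ A@(p ∷ q₁ ∷ q₂ ∷ r₁ ∷ r₂ ∷ r₃ ∷ []) = (∣ A ∣ ℕ.≤ᵇ 4) ∧ not (p ∧ q₁ ∧ q₂) ∧ not (p ∧ r₁ ∧ r₂ ∧ r₃)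

N₄ : Matroid 6
N₄ = Exhaustive.matroid indep₄ _ _ _

Realisable : ℕ → Set₁
Realisable d = ∃ λ (n : ℕ) → Σ (Matroid n) λ M → HasRank M d × Simple M × hVec M d d ≡ + 2

realisable-3 : Realisable 3
realisable-3 = 5 , N₃ , (bound , basis , _ , refl) , simple , refl
  where
    bound : RankAtMost N₃ 3
    bound = toWitness {a? = Exhaustive.rankAtMost? indep₃ 3} _
    basis : Subset 5
    basis = inside ∷ inside ∷ outside ∷ inside ∷ outside ∷ []
    simple : Simple N₃
    simple = toWitness {a? = Exhaustive.simple? indep₃} _

realisable-4 : Realisable 4
realisable-4 = 6 , N₄ , (bound , basis , _ , refl) , simple , refl
  where
    bound : RankAtMost N₄ 4
    bound = toWitness {a? = Exhaustive.rankAtMost? indep₄ 4} _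
    basis : Subset 6
    basis = inside ∷ inside ∷ outside ∷ inside ∷ inside ∷ outside ∷ []
    simple : Simple N₄
    simple = toWitness {a? = Exhaustive.simple? indep₄} _

realisable-+2 : ∀ d → Realisable d → Realisable (suc (suc d))
realisable-+2 d (n , M , rank , simple , h≡2) =
  3 ℕ.+ n , U₂,₃ ⊕ M ,
  ⊕-rank {M = U₂,₃} {M} U₂,₃-rank rank ,
  ⊕-simple {M = U₂,₃} {M} (uniform-simple ℕₚ.≤-refl) simple ,
  trans (hVec-triangle⊕ M d (proj₁ rank)) h≡2

realisable : ∀ k → Realisable (3 ℕ.+ k)
realisable zero          = realisable-3
realisable (suc zero)    = realisable-4
realisable (suc (suc k)) = realisable-+2 (3 ℕ.+ k) (realisable k)

theorem6p2 : (d : ℕ) → d ≥ 3 →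
    ∃ λ (n : ℕ) → Σ (Matroid n) λ M → HasRank M d × Simple M × hVec M d d ≡ + 2
theorem6p2 (suc (suc (suc k))) _ = realisable k
theorem6p2 0                 ()
theorem6p2 1                 (s≤s ())
theorem6p2 2                 (s≤s (s≤s ()))
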